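{- Let $b\ge1$ and let $q=(q_1,q_2,\ldots,q_k)$ be an ordered partition of $b$. Then the total number of embeddings (trivial and nontrivial) of $q$ into ordered partitions of $b$, i.e. the row sum $\sum_{r}(A_b)_{q,r}$ over all ordered partitions $r$ of $b$, equals \[ 1+\frac{q_1+2k-2}{q_1+k-1}\binom{q_1+k-1}{k-1}2^{q_1-1}. \]
   Context: An ordered partition (composition) of a positive integer $b$ is a finite sequence $(q_1,\ldots,q_k)$ of positive integers with $q_1+\cdots+q_k=b$. For ordered partitions $q=(q_1,\ldots,q_k)$ and $r=(r_1,\ldots,r_\ell)$ of $b$, a nontrivial embedding of $q$ into $r$ is a choice of indices $1\le i_2<i_3<\cdots<i_k\le \ell$ with $q_j\le r_{i_j}$ for all $2\le j\le k$ (distinct index choices are distinct embeddings; when $k=1$ there is exactly one, the empty choice). In addition, $q$ has exactly one trivial embedding into $r$ if $q=r$ and none otherwise. $A_b$ is the matrix with rows and columns indexed by the ordered partitions of $b$ whose $(q,r)$ entry is the number of nontrivial embeddings of $q$ into $r$ plus $1$ if $q=r$. -}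

module Defs where

open import Data.Nat using (ℕ; zero; suc; _+_; _≤_; _≤?_)
open import Data.List using (List; []; _∷_; map; concatMap; length)
open import Data.Nat.ListAction using (sum)
open import Data.List.Properties using (≡-dec)
open import Data.List.Relation.Unary.All using (All)
open import Data.Nat.Properties using (_≟_)
open import Relation.Binary.PropositionalEquality using (_≡_)
open import Relation.Nullary using (yes; no)
open import Data.Product using (_×_)

IsComposition : ℕ → List ℕ → Set
IsComposition b q = All (λ x → 1 ≤ x) q × sum q ≡ b

incHead : List ℕ → List ℕ
incHead []       = []
incHead (x ∷ xs) = suc x ∷ xs

-- compositionsSuc n : all compositions of (suc n), each exactly once.
-- Every composition of n+2 arises uniquely from one of n+1 either by
-- prepending a part 1 or by incrementing the first part.
compositionsSuc : ℕ → List (List ℕ)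
compositionsSuc zero    = (1 ∷ []) ∷ []
compositionsSuc (suc n) =
  concatMap (λ c → (1 ∷ c) ∷ incHead c ∷ []) (compositionsSuc n)

compositions : ℕ → List (List ℕ)
compositions zero    = [] ∷ []
compositions (suc n) = compositionsSuc n

-- subEmb t r : number of strictly increasing index choices i_1 < ... < i_m
-- into r with t_j ≤ r_{i_j} for all j (t = (t_1,...,t_m)).
subEmb : List ℕ → List ℕ → ℕ
subEmb []      r       = 1
subEmb (x ∷ t) []      = 0
subEmb (x ∷ t) (y ∷ r) with x ≤? y
... | yes _ = subEmb t r + subEmb (x ∷ t) r
... | no  _ = subEmb (x ∷ t) r

-- Number of nontrivial embeddings of q = (q_1,...,q_k) into r:
-- choices 1 ≤ i_2 < ... < i_k ≤ ℓ with q_j ≤ r_{i_j} for 2 ≤ j ≤ k.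
-- (For k = 1 this is 1, the empty choice; q = [] does not occur for b ≥ 1.)
nontrivialEmb : List ℕ → List ℕ → ℕ
nontrivialEmb []      r = 1
nontrivialEmb (_ ∷ t) r = subEmb t r

A : List ℕ → List ℕ → ℕ
A q r with ≡-dec _≟_ q r
... | yes _ = nontrivialEmb q r + 1
... | no  _ = nontrivialEmb q r

rowSum : ℕ → List ℕ → ℕ
rowSum b q = sum (map (A q) (compositions b))

-- Splitting off the row's diagonal entry, the row sum is 1 plus the number of pairs
-- (r, embedding of (q₂, …, q_k) into r) with r a composition of b.  Sorting such pairs
-- by the first part of r gives a recursion for these counts in which a list t enters
-- only through its length m and the excess s = b - Σ t; the count is then the
-- coefficient E(m, s) of z^s in (1 - z) / (1 - 2z)^(m+1), that is
-- 2^(s-1) ((m+s) C m + (m+s-1) C (m-1)) for s ≥ 1.  With s = q₁ and m = k - 1, the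
-- absorption identity (m+s) (m+s-1) C (m-1) = m (m+s) C m gives the formula.

module Submission where

open import Defs
open import Algebra.Properties.CommutativeSemigroup as CommSemigroupProperties using ()
open import Data.Bool.Base using (true; false; if_then_else_)
open import Data.List.Base using (List; []; _∷_; length; map; concatMap)
open import Data.List.Properties using (≡-dec; map-cong)
open import Data.List.Relation.Unary.All using (All; []; _∷_)
open import Data.Nat.Base using (ℕ; zero; suc; _+_; _*_; _∸_; _^_; _≤_; z≤n; s≤s; _≤ᵇ_; _≡ᵇ_)
open import Data.Nat.Combinatorics using (_C_; nCn≡1; nCk+nC[k+1]≡[n+1]C[k+1])
open import Data.Nat.ListAction using (sum)
open import Data.Nat.Properties
open import Data.Nat.Solver using (module +-*-Solver)
open import Data.Product.Base using (_,_)
open import Relation.Binary.PropositionalEquality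
open import Relation.Nullary using (does; yes; no)
open import Relation.Nullary.Decidable using (dec-true; dec-false)

open +-*-Solver using (solve; _:+_; _:*_; _:=_; con)
open CommSemigroupProperties +-commutativeSemigroup using (interchange)
open ≡-Reasoning

sum-map-+ : ∀ {X : Set} (f g : X → ℕ) (l : List X) →
  sum (map (λ x → f x + g x) l) ≡ sum (map f l) + sum (map g l)
sum-map-+ f g []      = refl
sum-map-+ f g (x ∷ l) =
  trans (cong (f x + g x +_) (sum-map-+ f g l)) (interchange (f x) (g x) _ _)

sum-map-if : ∀ {X : Set} b (f : X → ℕ) (l : List X) →
  sum (map (λ x → if b then f x else 0) l) ≡ (if b then sum (map f l) else 0)
sum-map-if true  f l       = refl
sum-map-if false f []      = refl
sum-map-if false f (x ∷ l) = sum-map-if false f l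

sum-map-concatMap-pair : ∀ {X Y : Set} (f : Y → ℕ) (u v : X → Y) (l : List X) →
  sum (map f (concatMap (λ x → u x ∷ v x ∷ []) l))
    ≡ sum (map (λ x → f (u x)) l) + sum (map (λ x → f (v x)) l)
sum-map-concatMap-pair f u v []      = refl
sum-map-concatMap-pair f u v (x ∷ l) = begin
    f (u x) + (f (v x) + sum (map f (concatMap (λ x → u x ∷ v x ∷ []) l)))
  ≡⟨ cong (λ z → f (u x) + (f (v x) + z)) (sum-map-concatMap-pair f u v l) ⟩
    f (u x) + (f (v x) + (U + V))
  ≡⟨ +-assoc (f (u x)) (f (v x)) (U + V) ⟨
    f (u x) + f (v x) + (U + V)
  ≡⟨ interchange (f (u x)) (f (v x)) U V ⟩
    f (u x) + U + (f (v x) + V)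
  ∎
  where
  U = sum (map (λ x → f (u x)) l)
  V = sum (map (λ x → f (v x)) l)

prefixSum : (ℕ → ℕ) → ℕ → ℕ
prefixSum f zero    = 0
prefixSum f (suc n) = f n + prefixSum f n

prefixSum-cong : ∀ {f g : ℕ → ℕ} → (∀ k → f k ≡ g k) → ∀ n → prefixSum f n ≡ prefixSum g n
prefixSum-cong f≗g zero    = refl
prefixSum-cong f≗g (suc n) = cong₂ _+_ (f≗g n) (prefixSum-cong f≗g n)

antidiagonalSum : (ℕ → ℕ → ℕ) → ℕ → ℕ
antidiagonalSum g zero    = g 0 0
antidiagonalSum g (suc n) = g 0 (suc n) + antidiagonalSum (λ j → g (suc j)) n

antidiagonalSum-cong : ∀ {g h : ℕ → ℕ → ℕ} → (∀ j k → g j k ≡ h j k) →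
  ∀ n → antidiagonalSum g n ≡ antidiagonalSum h n
antidiagonalSum-cong g≗h zero    = g≗h 0 0
antidiagonalSum-cong g≗h (suc n) =
  cong₂ _+_ (g≗h 0 (suc n)) (antidiagonalSum-cong (λ j → g≗h (suc j)) n)

antidiagonalSum-+ : ∀ (g h : ℕ → ℕ → ℕ) n →
  antidiagonalSum (λ j k → g j k + h j k) n ≡ antidiagonalSum g n + antidiagonalSum h n
antidiagonalSum-+ g h zero    = refl
antidiagonalSum-+ g h (suc n) =
  trans (cong (g 0 (suc n) + h 0 (suc n) +_)
              (antidiagonalSum-+ (λ j → g (suc j)) (λ j → h (suc j)) n))
        (interchange (g 0 (suc n)) (h 0 (suc n)) _ _)

antidiagonalSum-zero : ∀ n → antidiagonalSum (λ _ _ → 0) n ≡ 0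
antidiagonalSum-zero zero    = refl
antidiagonalSum-zero (suc n) = antidiagonalSum-zero n

antidiagonalSum-prefixSum : ∀ (f : ℕ → ℕ) n → antidiagonalSum (λ _ k → f k) n ≡ prefixSum f (suc n)
antidiagonalSum-prefixSum f zero    = sym (+-identityʳ (f 0))
antidiagonalSum-prefixSum f (suc n) = cong (f (suc n) +_) (antidiagonalSum-prefixSum f n)

antidiagonalSum-≤ᵇ : ∀ a (f : ℕ → ℕ) n →
  antidiagonalSum (λ j k → if suc a ≤ᵇ suc j then f k else 0) n ≡ prefixSum f (suc n ∸ a)
antidiagonalSum-≤ᵇ zero    f n       = antidiagonalSum-prefixSum f n
antidiagonalSum-≤ᵇ (suc a) f zero    = cong (prefixSum f) (sym (0∸n≡0 a))
antidiagonalSum-≤ᵇ (suc a) f (suc n) = antidiagonalSum-≤ᵇ a f n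

antidiagonalSum-≡ᵇ : ∀ a (f : ℕ → ℕ) m →
  antidiagonalSum (λ j k → if a ≡ᵇ j then f k else 0) (a + m) ≡ f m
antidiagonalSum-≡ᵇ zero    f zero    = refl
antidiagonalSum-≡ᵇ zero    f (suc m) =
  trans (cong (f (suc m) +_) (antidiagonalSum-zero m)) (+-identityʳ (f (suc m)))
antidiagonalSum-≡ᵇ (suc a) f m       = antidiagonalSum-≡ᵇ a f m

sum-compositions-suc : ∀ n (g : List ℕ → ℕ) →
  sum (map g (compositions (suc n)))
    ≡ antidiagonalSum (λ j k → sum (map (λ r → g (suc j ∷ r)) (compositions k))) n
sum-compositions-suc zero    g = refl
sum-compositions-suc (suc n) g =
  trans (sum-map-concatMap-pair g (1 ∷_) incHead (compositionsSuc n))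
        (cong (sum (map (λ r → g (1 ∷ r)) (compositionsSuc n)) +_)
              (sum-compositions-suc n (λ r → g (incHead r))))

subEmb-∷ : ∀ x t y r →
  subEmb (x ∷ t) (y ∷ r) ≡ (if does (x ≤? y) then subEmb t r else 0) + subEmb (x ∷ t) r
subEmb-∷ x t y r with x ≤? y
... | yes x≤y rewrite dec-true (x ≤? y) x≤y = refl
... | no  x≰y rewrite dec-false (x ≤? y) x≰y = refl

subEmbTotal : List ℕ → ℕ → ℕ
subEmbTotal t n = sum (map (subEmb t) (compositions n))

-- Split on the first part suc j of r: it either receives the first part suc x of t,
-- which is possible iff x ≤ j, or it receives nothing.
subEmbTotal-∷ : ∀ x t n →
  subEmbTotal (suc x ∷ t) (suc n)
    ≡ prefixSum (subEmbTotal t) (suc n ∸ x) + prefixSum (subEmbTotal (suc x ∷ t)) (suc n)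
subEmbTotal-∷ x t n = begin
    subEmbTotal (suc x ∷ t) (suc n)
  ≡⟨ sum-compositions-suc n (subEmb (suc x ∷ t)) ⟩
    antidiagonalSum (λ j k → sum (map (λ r → subEmb (suc x ∷ t) (suc j ∷ r)) (compositions k))) n
  ≡⟨ antidiagonalSum-cong split n ⟩
    antidiagonalSum (λ j k → (if suc x ≤ᵇ suc j then subEmbTotal t k else 0)
                             + subEmbTotal (suc x ∷ t) k) n
  ≡⟨ antidiagonalSum-+ _ (λ _ → subEmbTotal (suc x ∷ t)) n ⟩
    antidiagonalSum (λ j k → if suc x ≤ᵇ suc j then subEmbTotal t k else 0) n
      + antidiagonalSum (λ _ → subEmbTotal (suc x ∷ t)) n
  ≡⟨ cong₂ _+_ (antidiagonalSum-≤ᵇ x (subEmbTotal t) n)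
               (antidiagonalSum-prefixSum (subEmbTotal (suc x ∷ t)) n) ⟩
    prefixSum (subEmbTotal t) (suc n ∸ x) + prefixSum (subEmbTotal (suc x ∷ t)) (suc n)
  ∎
  where
  split : ∀ j k →
    sum (map (λ r → subEmb (suc x ∷ t) (suc j ∷ r)) (compositions k))
      ≡ (if suc x ≤ᵇ suc j then subEmbTotal t k else 0) + subEmbTotal (suc x ∷ t) k
  split j k = begin
      sum (map (λ r → subEmb (suc x ∷ t) (suc j ∷ r)) (compositions k))
    ≡⟨ cong sum (map-cong (subEmb-∷ (suc x) t (suc j)) (compositions k)) ⟩
      sum (map (λ r → (if suc x ≤ᵇ suc j then subEmb t r else 0) + subEmb (suc x ∷ t) r)
               (compositions k))
    ≡⟨ sum-map-+ _ (subEmb (suc x ∷ t)) (compositions k) ⟩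
      sum (map (λ r → if suc x ≤ᵇ suc j then subEmb t r else 0) (compositions k))
        + subEmbTotal (suc x ∷ t) k
    ≡⟨ cong (_+ subEmbTotal (suc x ∷ t) k) (sum-map-if (suc x ≤ᵇ suc j) (subEmb t) (compositions k)) ⟩
      (if suc x ≤ᵇ suc j then subEmbTotal t k else 0) + subEmbTotal (suc x ∷ t) k
    ∎

-- The coefficient of z ^ s in (1 - z) / (1 - 2 z) ^ (m + 1).
embeddingNumber : ℕ → ℕ → ℕ
embeddingNumber zero    zero    = 1
embeddingNumber zero    (suc s) = 2 ^ s
embeddingNumber (suc m) zero    = 1
embeddingNumber (suc m) (suc s) = 2 * embeddingNumber (suc m) s + embeddingNumber m (suc s)

subEmbTotal-[] : ∀ n → subEmbTotal [] n ≡ embeddingNumber 0 n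
subEmbTotal-[] zero          = refl
subEmbTotal-[] (suc zero)    = refl
subEmbTotal-[] (suc (suc n)) =
  trans (sum-map-concatMap-pair (subEmb []) (1 ∷_) incHead (compositionsSuc n))
        (cong₂ _+_ (subEmbTotal-[] (suc n))
                   (trans (subEmbTotal-[] (suc n)) (sym (+-identityʳ (2 ^ n)))))

embeddingNumber-zero : ∀ m → embeddingNumber m 0 ≡ 1
embeddingNumber-zero zero    = refl
embeddingNumber-zero (suc m) = refl

embeddingNumber-suc : ∀ m s →
  embeddingNumber (suc m) s
    ≡ prefixSum (embeddingNumber m) (suc s) + prefixSum (embeddingNumber (suc m)) s
embeddingNumber-suc m zero = sym (begin
    embeddingNumber m 0 + 0 + 0 ≡⟨ +-identityʳ _ ⟩
    embeddingNumber m 0 + 0     ≡⟨ +-identityʳ _ ⟩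
    embeddingNumber m 0         ≡⟨ embeddingNumber-zero m ⟩
    1                           ∎)
embeddingNumber-suc m (suc s) = begin
    2 * e + a
  ≡⟨ solve 2 (λ e a → con 2 :* e :+ a := (a :+ e) :+ e) refl e a ⟩
    a + e + e
  ≡⟨ cong (λ z → a + e + z) (embeddingNumber-suc m s) ⟩
    a + e + (P′ + P)
  ≡⟨ solve 4 (λ a e P′ P → a :+ e :+ (P′ :+ P) := a :+ P′ :+ (e :+ P)) refl a e P′ P ⟩
    a + P′ + (e + P)
  ∎
  where
  e  = embeddingNumber (suc m) s
  a  = embeddingNumber m (suc s)
  P′ = prefixSum (embeddingNumber m) (suc s)
  P  = prefixSum (embeddingNumber (suc m)) s

-- For k > n both sides vanish, so the recurrence survives truncated subtraction.
prefixSum-embeddingNumber-∸ : ∀ m n k →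
  prefixSum (embeddingNumber (suc m)) (suc n ∸ k)
    ≡ prefixSum (embeddingNumber m) (suc n ∸ k) + prefixSum (embeddingNumber (suc m)) (n ∸ k)
      + prefixSum (embeddingNumber (suc m)) (n ∸ k)
prefixSum-embeddingNumber-∸ m n k with k ≤? n
... | yes k≤n = begin
    P (suc n ∸ k)               ≡⟨ cong P (+-∸-assoc 1 k≤n) ⟩
    P (suc (n ∸ k))             ≡⟨ cong (_+ P (n ∸ k)) (embeddingNumber-suc m (n ∸ k)) ⟩
    P′ (suc (n ∸ k)) + P (n ∸ k) + P (n ∸ k)
                                ≡⟨ cong (λ d → P′ d + P (n ∸ k) + P (n ∸ k)) (+-∸-assoc 1 k≤n) ⟨
    P′ (suc n ∸ k) + P (n ∸ k) + P (n ∸ k) ∎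
  where
  P  = prefixSum (embeddingNumber (suc m))
  P′ = prefixSum (embeddingNumber m)
... | no  k≰n
  rewrite m≤n⇒m∸n≡0 (≰⇒> k≰n) | m≤n⇒m∸n≡0 (<⇒≤ (≰⇒> k≰n)) = refl

prefixSum-subEmbTotal : ∀ t → All (1 ≤_) t → ∀ n →
  prefixSum (subEmbTotal t) n ≡ prefixSum (embeddingNumber (length t)) (n ∸ sum t)
prefixSum-subEmbTotal []          []              = prefixSum-cong subEmbTotal-[]
prefixSum-subEmbTotal (suc x ∷ t) (s≤s z≤n ∷ t⁺) = go
  where
  K  = x + sum t
  W  = subEmbTotal (suc x ∷ t)
  P  = prefixSum W
  F  = prefixSum (embeddingNumber (suc (length t)))
  F′ = prefixSum (embeddingNumber (length t))

  go : ∀ n → P n ≡ F (n ∸ suc K)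
  go zero          = refl
  go (suc zero)    = cong F (sym (0∸n≡0 K))
  go (suc (suc n)) = begin
      W (suc n) + P (suc n)
    ≡⟨ cong (_+ P (suc n)) (subEmbTotal-∷ x t n) ⟩
      prefixSum (subEmbTotal t) (suc n ∸ x) + P (suc n) + P (suc n)
    ≡⟨ cong₂ (λ a b → a + b + b)
             (trans (prefixSum-subEmbTotal t t⁺ (suc n ∸ x)) (cong F′ (∸-+-assoc (suc n) x (sum t))))
             (go (suc n)) ⟩
      F′ (suc n ∸ K) + F (n ∸ K) + F (n ∸ K)
    ≡⟨ prefixSum-embeddingNumber-∸ (length t) n K ⟨
      F (suc n ∸ K)
    ∎

subEmbTotal-excess : ∀ t → All (1 ≤_) t → ∀ s →
  subEmbTotal t (sum t + s) ≡ embeddingNumber (length t) s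
subEmbTotal-excess t t⁺ s = +-cancelʳ-≡ (P (T + s)) _ _ (begin
    subEmbTotal t (T + s) + P (T + s)
  ≡⟨ prefixSum-subEmbTotal t t⁺ (suc (T + s)) ⟩
    F (suc (T + s) ∸ T)
  ≡⟨ cong F (trans (cong (_∸ T) (sym (+-suc T s))) (m+n∸m≡n T (suc s))) ⟩
    embeddingNumber (length t) s + F s
  ≡⟨ cong (embeddingNumber (length t) s +_)
          (trans (prefixSum-subEmbTotal t t⁺ (T + s)) (cong F (m+n∸m≡n T s))) ⟨
    embeddingNumber (length t) s + P (T + s)
  ∎)
  where
  T = sum t
  P = prefixSum (subEmbTotal t)
  F = prefixSum (embeddingNumber (length t))

δ : List ℕ → List ℕ → ℕ
δ q r = if does (≡-dec _≟_ q r) then 1 else 0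

A≡nontrivialEmb+δ : ∀ q r → A q r ≡ nontrivialEmb q r + δ q r
A≡nontrivialEmb+δ q r with ≡-dec _≟_ q r
... | yes _ = refl
... | no  _ = sym (+-identityʳ _)

δ-∷ : ∀ a j q r → δ (suc a ∷ q) (suc j ∷ r) ≡ (if a ≡ᵇ j then δ q r else 0)
δ-∷ a j q r with a ≡ᵇ j
... | true  = refl
... | false = refl

sum-δ-compositions : ∀ q → All (1 ≤_) q → sum (map (δ q) (compositions (sum q))) ≡ 1
sum-δ-compositions []          []              = refl
sum-δ-compositions (suc a ∷ q) (s≤s z≤n ∷ q⁺) = begin
    sum (map (δ (suc a ∷ q)) (compositions (suc (a + sum q))))
  ≡⟨ sum-compositions-suc (a + sum q) (δ (suc a ∷ q)) ⟩
    antidiagonalSum (λ j k → sum (map (λ r → δ (suc a ∷ q) (suc j ∷ r)) (compositions k))) (a + sum q)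
  ≡⟨ antidiagonalSum-cong first-part (a + sum q) ⟩
    antidiagonalSum (λ j k → if a ≡ᵇ j then sum (map (δ q) (compositions k)) else 0) (a + sum q)
  ≡⟨ antidiagonalSum-≡ᵇ a (λ k → sum (map (δ q) (compositions k))) (sum q) ⟩
    sum (map (δ q) (compositions (sum q)))
  ≡⟨ sum-δ-compositions q q⁺ ⟩
    1
  ∎
  where
  first-part : ∀ j k →
    sum (map (λ r → δ (suc a ∷ q) (suc j ∷ r)) (compositions k))
      ≡ (if a ≡ᵇ j then sum (map (δ q) (compositions k)) else 0)
  first-part j k = trans (cong sum (map-cong (δ-∷ a j q) (compositions k)))
                         (sum-map-if (a ≡ᵇ j) (δ q) (compositions k))

rowSum-∷ : ∀ s qs → All (1 ≤_) qs →
  rowSum (suc s + sum qs) (suc s ∷ qs) ≡ embeddingNumber (length qs) (suc s) + 1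
rowSum-∷ s qs qs⁺ = begin
    sum (map (A q) (compositions b))
  ≡⟨ cong sum (map-cong (A≡nontrivialEmb+δ q) (compositions b)) ⟩
    sum (map (λ r → subEmb qs r + δ q r) (compositions b))
  ≡⟨ sum-map-+ (subEmb qs) (δ q) (compositions b) ⟩
    subEmbTotal qs b + sum (map (δ q) (compositions b))
  ≡⟨ cong₂ _+_ (trans (cong (subEmbTotal qs) (+-comm (suc s) (sum qs)))
                      (subEmbTotal-excess qs qs⁺ (suc s)))
               (sum-δ-compositions q (s≤s z≤n ∷ qs⁺)) ⟩
    embeddingNumber (length qs) (suc s) + 1
  ∎
  where
  q = suc s ∷ qs
  b = suc s + sum qs

binomial : ℕ → ℕ → ℕ
binomial zero    b       = 1
binomial (suc a) zero    = 1
binomial (suc a) (suc b) = binomial a (suc b) + binomial (suc a) b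

binomial-zero : ∀ a → binomial a 0 ≡ 1
binomial-zero zero    = refl
binomial-zero (suc a) = refl

binomial-C : ∀ a b → binomial a b ≡ (a + b) C a
binomial-C zero    b       = refl
binomial-C (suc a) zero    =
  trans (sym (nCn≡1 (suc a))) (cong (_C suc a) (sym (+-identityʳ (suc a))))
binomial-C (suc a) (suc b) = begin
    binomial a (suc b) + binomial (suc a) b
  ≡⟨ cong₂ _+_ (binomial-C a (suc b))
               (trans (binomial-C (suc a) b) (cong (_C suc a) (sym (+-suc a b)))) ⟩
    (a + suc b) C a + (a + suc b) C suc a
  ≡⟨ nCk+nC[k+1]≡[n+1]C[k+1] (a + suc b) a ⟩
    suc (a + suc b) C suc a
  ∎

binomial-absorbˡ : ∀ a b → suc a * binomial (suc a) b ≡ suc (a + b) * binomial a b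
binomial-absorbʳ : ∀ a b → suc b * binomial a (suc b) ≡ suc (a + b) * binomial a b

binomial-absorbˡ a zero    rewrite binomial-zero a | +-identityʳ a = refl
binomial-absorbˡ a (suc b) = begin
    suc a * (binomial a (suc b) + binomial (suc a) b)
  ≡⟨ *-distribˡ-+ (suc a) (binomial a (suc b)) (binomial (suc a) b) ⟩
    suc a * binomial a (suc b) + suc a * binomial (suc a) b
  ≡⟨ cong (suc a * binomial a (suc b) +_)
          (trans (binomial-absorbˡ a b) (sym (binomial-absorbʳ a b))) ⟩
    suc a * binomial a (suc b) + suc b * binomial a (suc b)
  ≡⟨ solve 3 (λ a b x → (con 1 :+ a) :* x :+ (con 1 :+ b) :* x
                        := (con 1 :+ (a :+ (con 1 :+ b))) :* x) refl a b (binomial a (suc b)) ⟩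
    suc (a + suc b) * binomial a (suc b)
  ∎

binomial-absorbʳ zero    b = refl
binomial-absorbʳ (suc a) b = begin
    suc b * (binomial a (suc b) + binomial (suc a) b)
  ≡⟨ *-distribˡ-+ (suc b) (binomial a (suc b)) (binomial (suc a) b) ⟩
    suc b * binomial a (suc b) + suc b * binomial (suc a) b
  ≡⟨ cong (_+ suc b * binomial (suc a) b)
          (trans (binomial-absorbʳ a b) (sym (binomial-absorbˡ a b))) ⟩
    suc a * binomial (suc a) b + suc b * binomial (suc a) b
  ≡⟨ solve 3 (λ a b x → (con 1 :+ a) :* x :+ (con 1 :+ b) :* x
                        := (con 1 :+ (con 1 :+ a :+ b)) :* x) refl a b (binomial (suc a) b) ⟩
    suc (suc a + b) * binomial (suc a) b
  ∎

binomialPair : ℕ → ℕ → ℕ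
binomialPair zero    s = 1
binomialPair (suc m) s = binomial (suc m) (suc s) + binomial m (suc s)

binomialPair-suc : ∀ m s →
  binomialPair (suc m) (suc s) ≡ binomialPair (suc m) s + binomialPair m (suc s)
binomialPair-suc zero    s =
  solve 1 (λ x → con 1 :+ x :+ con 1 := x :+ con 1 :+ con 1) refl (binomial 1 (suc s))
binomialPair-suc (suc m) s =
  solve 3 (λ x y z → x :+ y :+ z :+ (x :+ y) := z :+ y :+ (x :+ y :+ x)) refl
    (binomial m (suc (suc s))) (binomial (suc m) (suc s)) (binomial (suc (suc m)) (suc s))

binomialPair-zero : ∀ m → binomialPair (suc m) 0 ≡ 2 + binomialPair m 0
binomialPair-zero zero    = refl
binomialPair-zero (suc m) =
  solve 1 (λ x → x :+ con 1 :+ con 1 :+ (x :+ con 1) := con 2 :+ (x :+ con 1 :+ x)) refl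
    (binomial m 1)

embeddingNumber-closed : ∀ m s → embeddingNumber m (suc s) ≡ 2 ^ s * binomialPair m s
embeddingNumber-closed zero    s       = sym (*-identityʳ (2 ^ s))
embeddingNumber-closed (suc m) zero    = begin
    2 + embeddingNumber m 1     ≡⟨ cong (2 +_) (trans (embeddingNumber-closed m 0) (*-identityˡ _)) ⟩
    2 + binomialPair m 0        ≡⟨ binomialPair-zero m ⟨
    binomialPair (suc m) 0      ≡⟨ *-identityˡ _ ⟨
    1 * binomialPair (suc m) 0  ∎
embeddingNumber-closed (suc m) (suc s) = begin
    2 * embeddingNumber (suc m) (suc s) + embeddingNumber m (suc (suc s))
  ≡⟨ cong₂ (λ x y → 2 * x + y) (embeddingNumber-closed (suc m) s) (embeddingNumber-closed m (suc s)) ⟩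
    2 * (2 ^ s * binomialPair (suc m) s) + 2 * 2 ^ s * binomialPair m (suc s)
  ≡⟨ solve 3 (λ p x y → con 2 :* (p :* x) :+ con 2 :* p :* y := con 2 :* p :* (x :+ y)) refl
       (2 ^ s) (binomialPair (suc m) s) (binomialPair m (suc s)) ⟩
    2 ^ suc s * (binomialPair (suc m) s + binomialPair m (suc s))
  ≡⟨ cong (2 ^ suc s *_) (binomialPair-suc m s) ⟨
    2 ^ suc s * binomialPair (suc m) (suc s)
  ∎

binomialPair-absorb : ∀ m s →
  (suc s + m) * binomialPair m s ≡ (suc s + 2 * m) * binomial m (suc s)
binomialPair-absorb zero    s = refl
binomialPair-absorb (suc m) s = begin
    (suc s + suc m) * (x + y)
  ≡⟨ solve 4 (λ s m x y → (con 1 :+ s :+ (con 1 :+ m)) :* (x :+ y)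
                          := (con 1 :+ s :+ (con 1 :+ m)) :* x :+ (con 1 :+ (m :+ (con 1 :+ s))) :* y)
       refl s m x y ⟩
    (suc s + suc m) * x + suc (m + suc s) * y
  ≡⟨ cong ((suc s + suc m) * x +_) (binomial-absorbˡ m (suc s)) ⟨
    (suc s + suc m) * x + suc m * x
  ≡⟨ solve 3 (λ s m x → (con 1 :+ s :+ (con 1 :+ m)) :* x :+ (con 1 :+ m) :* x
                        := (con 1 :+ s :+ con 2 :* (con 1 :+ m)) :* x) refl s m x ⟩
    (suc s + 2 * suc m) * x
  ∎
  where
  x = binomial (suc m) (suc s)
  y = binomial m (suc s)

lemma3 : (b : ℕ) → 1 ≤ b → (q₁ : ℕ) → (qs : List ℕ) →
    IsComposition b (q₁ ∷ qs) →
    (q₁ + (length (q₁ ∷ qs) ∸ 1)) * rowSum b (q₁ ∷ qs)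
      ≡ (q₁ + (length (q₁ ∷ qs) ∸ 1))
        + (q₁ + 2 * (length (q₁ ∷ qs) ∸ 1))
          * ((q₁ + (length (q₁ ∷ qs) ∸ 1)) C (length (q₁ ∷ qs) ∸ 1))
          * 2 ^ (q₁ ∸ 1)
lemma3 _ _ (suc s) qs ((s≤s z≤n ∷ qs⁺) , refl) = begin
    N * rowSum (suc s + sum qs) (suc s ∷ qs)
  ≡⟨ cong (N *_) (rowSum-∷ s qs qs⁺) ⟩
    N * (embeddingNumber m (suc s) + 1)
  ≡⟨ cong (λ e → N * (e + 1)) (embeddingNumber-closed m s) ⟩
    N * (2 ^ s * binomialPair m s + 1)
  ≡⟨ solve 3 (λ n p x → n :* (p :* x :+ con 1) := n :+ n :* x :* p) refl N (2 ^ s) (binomialPair m s) ⟩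
    N + N * binomialPair m s * 2 ^ s
  ≡⟨ cong (λ z → N + z * 2 ^ s) (binomialPair-absorb m s) ⟩
    N + (suc s + 2 * m) * binomial m (suc s) * 2 ^ s
  ≡⟨ cong (λ z → N + (suc s + 2 * m) * z * 2 ^ s)
          (trans (binomial-C m (suc s)) (cong (_C m) (+-comm m (suc s)))) ⟩
    N + (suc s + 2 * m) * (N C m) * 2 ^ s
  ∎
  where
  m = length qs
  N = suc s + m
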